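{- (1) Let $Q$ be a definite quaternion algebra over $\mathbb{Q}$, $O$ a $\mathbb{Z}$-order in $Q$, and $n\ge1$. Then $U(n,O):=\{A\in\mathrm{Mat}_n(O):A\cdot A^*=\mathbb{I}_n\}$ equals $\mathrm{diag}(O^\times,\dots,O^\times)\cdot S_n$, i.e. the group of $n\times n$ matrices with exactly one nonzero entry in each row and column, that entry lying in $O^\times$. (2) Let $O$ be a maximal order in $B_{2,\infty}$ and $m_2:U(n,O)\to\mathrm{GL}_n(O/2O)$ the reduction-modulo-$2$ map. Then $\ker(m_2)=\mathrm{diag}(\{\pm1\},\dots,\{\pm1\})\cong C_2^n$.
   Context: For a matrix $A=(a_{ij})$ over a quaternion algebra, $A^*$ denotes the conjugate transpose $(a_{ji}^*)$ with $*$ the canonical involution. $S_n$ acts by permutation matrices. $B_{2,\infty}$ is the definite quaternion algebra over $\mathbb{Q}$ ramified exactly at $2$ and $\infty$. $C_2$ is the cyclic group of order $2$. -}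

module Defs where

open import Data.Nat using (ℕ)
open import Data.Integer using (ℤ)
open import Data.Rational using (ℚ; 0ℚ; 1ℚ; _+_; _*_; -_; _/_)
open import Data.Fin using (Fin)
open import Data.Fin.Permutation using (Permutation′; _⟨$⟩ʳ_)
open import Data.Product using (Σ; _×_; ∃)
open import Data.Sum using (_⊎_)
open import Relation.Nullary using (yes; no)
import Data.Fin
open import Relation.Binary.PropositionalEquality using (_≡_; _≢_)
open import Relation.Nullary using (¬_)
open import Level using (Level; _⊔_; suc)

-- Elements of the quaternion algebra (a,b)_ℚ, written x0 + x1 i + x2 j + x3 k
-- with i² = a, j² = b, k = ij = -ji.
record Quat : Set where
  constructor quat
  field
    q0 q1 q2 q3 : ℚ
open Quat public

infixl 6 _⊕_
_⊕_ : Quat → Quat → Quat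
quat x0 x1 x2 x3 ⊕ quat y0 y1 y2 y3 = quat (x0 + y0) (x1 + y1) (x2 + y2) (x3 + y3)

⊖_ : Quat → Quat
⊖ quat x0 x1 x2 x3 = quat (- x0) (- x1) (- x2) (- x3)

zeroQ oneQ : Quat
zeroQ = quat 0ℚ 0ℚ 0ℚ 0ℚ
oneQ  = quat 1ℚ 0ℚ 0ℚ 0ℚ

_·_ : ℚ → Quat → Quat
c · quat x0 x1 x2 x3 = quat (c * x0) (c * x1) (c * x2) (c * x3)

mulQ : ℚ → ℚ → Quat → Quat → Quat
mulQ a b (quat x0 x1 x2 x3) (quat y0 y1 y2 y3) = quat
  (x0 * y0 + a * (x1 * y1) + b * (x2 * y2) + - (a * b) * (x3 * y3))
  (x0 * y1 + x1 * y0 + - b * (x2 * y3) + b * (x3 * y2))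
  (x0 * y2 + x2 * y0 + a * (x1 * y3) + - a * (x3 * y1))
  (x0 * y3 + x3 * y0 + x1 * y2 + - (x2 * y1))

conj : Quat → Quat
conj (quat x0 x1 x2 x3) = quat x0 (- x1) (- x2) (- x3)

-- (a,b)_ℚ is definite (ramified at ∞) iff a < 0 and b < 0.
IsDefinite : ℚ → ℚ → Set
IsDefinite a b = (a Data.Rational.< 0ℚ) × (b Data.Rational.< 0ℚ)

sumFin : ∀ {n} → (Fin n → Quat) → Quat
sumFin {ℕ.zero} f = zeroQ
sumFin {ℕ.suc n} f = f Fin.zero ⊕ sumFin (λ i → f (Fin.suc i))

ℤ→ℚ : ℤ → ℚ
ℤ→ℚ z = z / 1

Subset : Set₁
Subset = Quat → Set

-- A ℤ-order in (a,b)_ℚ: a subring (containing 1, closed under multiplication)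
-- which is a full ℤ-lattice, i.e. the ℤ-span of a ℚ-basis of the algebra.
record IsOrder (a b : ℚ) (O : Subset) : Set where
  field
    basis      : Fin 4 → Quat
    lattice    : ∀ x → (O x → ∃ λ (c : Fin 4 → ℤ) → x ≡ sumFin (λ i → ℤ→ℚ (c i) · basis i))
                     × ((c : Fin 4 → ℤ) → x ≡ sumFin (λ i → ℤ→ℚ (c i) · basis i) → O x)
    independent : (c : Fin 4 → ℚ) → sumFin (λ i → c i · basis i) ≡ zeroQ → ∀ i → c i ≡ 0ℚ
    has-one    : O oneQ
    mul-closed : ∀ x y → O x → O y → O (mulQ a b x y)

IsMaximalOrder : ℚ → ℚ → Subset → Set₁
IsMaximalOrder a b O = IsOrder a b O
  × ((O′ : Subset) → IsOrder a b O′ → (∀ x → O x → O′ x) → ∀ x → O′ x → O x)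

IsUnitIn : ℚ → ℚ → Subset → Quat → Set
IsUnitIn a b O u = O u × ∃ λ v → O v × (mulQ a b u v ≡ oneQ) × (mulQ a b v u ≡ oneQ)

Mat : ℕ → Set
Mat n = Fin n → Fin n → Quat

EntriesIn : ∀ {n} → Subset → Mat n → Set
EntriesIn O A = ∀ i j → O (A i j)

idMat : ∀ {n} → Mat n
idMat i j with i Data.Fin.≟ j
... | yes _ = oneQ
... | no _ = zeroQ

-- A · A* = I, where (A*)_{kj} = conj (A_{jk})
IsUnitary : ℚ → ℚ → ∀ {n} → Mat n → Set
IsUnitary a b A = ∀ i j → sumFin (λ k → mulQ a b (A i k) (conj (A j k))) ≡ idMat i j

-- exactly one nonzero entry in each row and column, lying in O^×
-- (i.e. A ∈ diag(O^×,…,O^×)·S_n)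
IsMonomialUnit : ℚ → ℚ → Subset → ∀ {n} → Mat n → Set
IsMonomialUnit a b O {n} A = Σ (Permutation′ n) λ σ →
  ∀ i j → ((j ≡ σ ⟨$⟩ʳ i) → IsUnitIn a b O (A i j)) × ((j ≢ σ ⟨$⟩ʳ i) → A i j ≡ zeroQ)

twoℚ : ℚ
twoℚ = 1ℚ + 1ℚ

-- kernel of reduction mod 2O: A ≡ I (mod 2·Mat_n(O))
InKerMod2 : Subset → ∀ {n} → Mat n → Set
InKerMod2 O A = ∀ i j → ∃ λ y → O y × (A i j ⊕ ⊖ idMat i j ≡ twoℚ · y)

IsDiagSigns : ∀ {n} → Mat n → Set
IsDiagSigns A = ∀ i j → (i ≡ j → (A i j ≡ oneQ) ⊎ (A i j ≡ ⊖ oneQ)) × (i ≢ j → A i j ≡ zeroQ)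

{-# OPTIONS --safe #-}
module Submission where

-- The reduced norm N is a positive definite quadratic form which is ℤ-valued on an order O:
-- the lattice O has bounded denominators, so E · N(x)ᵏ = E · N(xᵏ) ∈ ℤ for a fixed E and all k,
-- which forces N(x) ∈ ℤ.  The trace N(x + 1) − N(x) − 1 is then integral too, so O is closed
-- under conjugation and its norm-one elements are exactly its units.  In a row of a unitary
-- matrix over O the norms are natural numbers summing to 1, so the matrix is monomial.
-- Modulo 2: an element of norm 1 is never in 2O since N(2y) = 4 N(y); and if u = 1 + 2y has
-- norm 1 then y₀ = −N(y), so the vector part of y has norm N(y) − N(y)² ≥ 0, N(y) ∈ {0, 1} and
-- u = ±1.

open import Data.Empty using (⊥-elim)
open import Data.Fin using (Fin; zero; suc; punchOut)
import Data.Fin.Properties as FinP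
open import Data.Fin.Permutation as Perm using (Permutation′; permutation; _⟨$⟩ʳ_; _⟨$⟩ˡ_; inverseˡ)
open import Data.Integer as ℤ using (ℤ; +_; -[1+_])
import Data.Integer.Properties as ℤP
open import Data.Integer.Tactic.RingSolver using (solve-∀)
open import Data.Nat as ℕ using (ℕ; NonZero; _≥_)
import Data.Nat.Coprimality as ℕC
import Data.Nat.Divisibility as ℕD
import Data.Nat.Properties as ℕP
open import Algebra.Properties.CommutativeSemigroup ℕP.*-commutativeSemigroup using (x∙yz≈y∙xz)
open import Algebra.Properties.Monoid.Sum ℕP.+-0-monoid using (sum)
open import Data.Product using (Σ; ∃; _×_; _,_; proj₁; proj₂)
open import Data.Rational as ℚ using (ℚ; mkℚ; 0ℚ; 1ℚ; ½; _+_; _*_; -_; ↥_; ↧_; ↧ₙ_; toℚᵘ)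
import Data.Rational.Properties as ℚP
open import Data.Rational.Solver using (module +-*-Solver)
open +-*-Solver using (Polynomial; con; _:+_; _:*_; :-_; _:=_; solve)
open import Data.Rational.Unnormalised as ℚᵘ using (mkℚᵘ; *≡*) renaming (_≃_ to _≃ᵘ_)
import Data.Rational.Unnormalised.Properties as ℚᵘP
open import Data.Sum using (_⊎_; inj₁; inj₂)
open import Defs
open import Function using (_∘_; flip)
open import Function.Bundles using (_⇔_; mk⇔)
open import Function.Definitions using (Injective)
open import Relation.Binary.Definitions using (tri<; tri≈; tri>)
open import Relation.Binary.PropositionalEquality
open import Relation.Nullary using (Dec; yes; no)

-- Integers and natural numbers inside ℚ

IsInteger : ℚ → Set
IsInteger r = ∃ λ z → r ≡ ℤ→ℚ z

coprimeTo1 : ∀ n → ℕC.Coprime n 1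
coprimeTo1 n = ℕC.sym (ℕC.1-coprimeTo n)

ℤ→ℚ≡mkℚ : ∀ z → ℤ→ℚ z ≡ mkℚ z 0 (coprimeTo1 ℤ.∣ z ∣)
ℤ→ℚ≡mkℚ (+ n)    = ℚP.normalize-coprime (coprimeTo1 n)
ℤ→ℚ≡mkℚ -[1+ n ] = cong -_ (ℚP.normalize-coprime (coprimeTo1 (ℕ.suc n)))

ℤ→ℚ-injective : ∀ {x y} → ℤ→ℚ x ≡ ℤ→ℚ y → x ≡ y
ℤ→ℚ-injective {x} {y} eq = begin
  x              ≡⟨ cong ↥_ (ℤ→ℚ≡mkℚ x) ⟨
  ↥ (ℤ→ℚ x)      ≡⟨ cong ↥_ eq ⟩
  ↥ (ℤ→ℚ y)      ≡⟨ cong ↥_ (ℤ→ℚ≡mkℚ y) ⟩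
  y              ∎
  where open ≡-Reasoning

ℤ→ℚ-homo-+ : ∀ x y → ℤ→ℚ (x ℤ.+ y) ≡ ℤ→ℚ x + ℤ→ℚ y
ℤ→ℚ-homo-+ x y = begin
  ℤ→ℚ (x ℤ.+ y)                  ≡⟨ cong ℤ→ℚ (cong₂ ℤ._+_ (ℤP.*-identityʳ x) (ℤP.*-identityʳ y)) ⟨
  ℤ→ℚ (x ℤ.* + 1 ℤ.+ y ℤ.* + 1)  ≡⟨ cong₂ _+_ (ℤ→ℚ≡mkℚ x) (ℤ→ℚ≡mkℚ y) ⟨
  ℤ→ℚ x + ℤ→ℚ y                  ∎
  where open ≡-Reasoning

ℤ→ℚ-homo-* : ∀ x y → ℤ→ℚ (x ℤ.* y) ≡ ℤ→ℚ x * ℤ→ℚ y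
ℤ→ℚ-homo-* x y = sym (cong₂ _*_ (ℤ→ℚ≡mkℚ x) (ℤ→ℚ≡mkℚ y))

ℤ→ℚ-homo‿- : ∀ x → ℤ→ℚ (ℤ.- x) ≡ - ℤ→ℚ x
ℤ→ℚ-homo‿- x = begin
  ℤ→ℚ (ℤ.- x)            ≡⟨ cong ℤ→ℚ (ℤP.-1*i≡-i x) ⟨
  ℤ→ℚ (ℤ.-1ℤ ℤ.* x)      ≡⟨ ℤ→ℚ-homo-* ℤ.-1ℤ x ⟩
  - 1ℚ * ℤ→ℚ x           ≡⟨ ℚP.neg-distribˡ-* 1ℚ (ℤ→ℚ x) ⟨
  - (1ℚ * ℤ→ℚ x)         ≡⟨ cong -_ (ℚP.*-identityˡ (ℤ→ℚ x)) ⟩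
  - ℤ→ℚ x                ∎
  where open ≡-Reasoning

ℤ→ℚ-cancel-≤ : ∀ {x y} → ℤ→ℚ x ℚ.≤ ℤ→ℚ y → x ℤ.≤ y
ℤ→ℚ-cancel-≤ {x} {y} le rewrite ℤ→ℚ≡mkℚ x | ℤ→ℚ≡mkℚ y =
  subst₂ ℤ._≤_ (ℤP.*-identityʳ x) (ℤP.*-identityʳ y) (ℚP.drop-*≤* le)

toℚᵘ-ℤ→ℚ : ∀ z → toℚᵘ (ℤ→ℚ z) ≃ᵘ mkℚᵘ z 0
toℚᵘ-ℤ→ℚ z rewrite ℤ→ℚ≡mkℚ z = ℚᵘP.≃-refl

IsInteger-ℤ→ℚ : ∀ z → IsInteger (ℤ→ℚ z)
IsInteger-ℤ→ℚ z = z , refl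

IsInteger-+ : ∀ {r s} → IsInteger r → IsInteger s → IsInteger (r + s)
IsInteger-+ (x , refl) (y , refl) = x ℤ.+ y , sym (ℤ→ℚ-homo-+ x y)

IsInteger-* : ∀ {r s} → IsInteger r → IsInteger s → IsInteger (r * s)
IsInteger-* (x , refl) (y , refl) = x ℤ.* y , sym (ℤ→ℚ-homo-* x y)

IsInteger-neg : ∀ {r} → IsInteger r → IsInteger (- r)
IsInteger-neg (x , refl) = ℤ.- x , sym (ℤ→ℚ-homo‿- x)

ℕ→ℚ : ℕ → ℚ
ℕ→ℚ n = ℤ→ℚ (+ n)

IsNatural : ℚ → Set
IsNatural r = ∃ λ n → r ≡ ℕ→ℚ n

ℕ→ℚ-injective : ∀ {m n} → ℕ→ℚ m ≡ ℕ→ℚ n → m ≡ n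
ℕ→ℚ-injective eq = ℤP.+-injective (ℤ→ℚ-injective eq)

ℕ→ℚ-homo-+ : ∀ m n → ℕ→ℚ (m ℕ.+ n) ≡ ℕ→ℚ m + ℕ→ℚ n
ℕ→ℚ-homo-+ m n = trans (cong ℤ→ℚ (ℤP.pos-+ m n)) (ℤ→ℚ-homo-+ (+ m) (+ n))

ℕ→ℚ-homo-* : ∀ m n → ℕ→ℚ (m ℕ.* n) ≡ ℕ→ℚ m * ℕ→ℚ n
ℕ→ℚ-homo-* m n = trans (cong ℤ→ℚ (ℤP.pos-* m n)) (ℤ→ℚ-homo-* (+ m) (+ n))

nonNegative-integer⇒natural : ∀ {r} → 0ℚ ℚ.≤ r → IsInteger r → IsNatural r
nonNegative-integer⇒natural 0≤r (+ n , eq)      = n , eq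
nonNegative-integer⇒natural 0≤r (-[1+ n ] , eq) with ℤ→ℚ-cancel-≤ {+ 0} { -[1+ n ]} (subst (0ℚ ℚ.≤_) eq 0≤r)
... | ()

x*yz≡y*xz : ∀ x y z → x * (y * z) ≡ y * (x * z)
x*yz≡y*xz = solve 3 (λ x y z → x :* (y :* z) := y :* (x :* z)) refl

x-y+y≡x : ∀ x y → x + - y + y ≡ x
x-y+y≡x = solve 2 (λ x y → x :+ :- y :+ y := x) refl

0<x*x : ∀ {x} → x ≢ 0ℚ → 0ℚ ℚ.< x * x
0<x*x {x} x≢0 with ℚP.<-cmp x 0ℚ
... | tri< x<0 _ _ = ℚP.positive⁻¹ _ {{ℚP.neg*neg⇒pos x {{ℚ.negative x<0}} x {{ℚ.negative x<0}}}}
... | tri≈ _ x≡0 _ = ⊥-elim (x≢0 x≡0)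
... | tri> _ _ x>0 = ℚP.positive⁻¹ _ {{ℚP.pos*pos⇒pos x {{ℚ.positive x>0}} x {{ℚ.positive x>0}}}}

0<c*x*x : ∀ {c x} → 0ℚ ℚ.< c → x ≢ 0ℚ → 0ℚ ℚ.< c * (x * x)
0<c*x*x {c} {x} 0<c x≢0 =
  ℚP.positive⁻¹ (c * (x * x)) {{ℚP.pos*pos⇒pos c {{ℚ.positive 0<c}} (x * x) {{ℚ.positive (0<x*x x≢0)}}}}

0≤c*x*x : ∀ {c} x → 0ℚ ℚ.< c → 0ℚ ℚ.≤ c * (x * x)
0≤c*x*x {c} x 0<c with x ℚP.≟ 0ℚ
... | yes refl = ℚP.≤-reflexive (sym (ℚP.*-zeroʳ c))
... | no x≢0   = ℚP.<⇒≤ (0<c*x*x 0<c x≢0)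

c*x*x≡0⇒x≡0 : ∀ {c x} → 0ℚ ℚ.< c → c * (x * x) ≡ 0ℚ → x ≡ 0ℚ
c*x*x≡0⇒x≡0 {c} {x} 0<c cxx≡0 with x ℚP.≟ 0ℚ
... | yes x≡0 = x≡0
... | no x≢0  = ⊥-elim (ℚP.<-irrefl (sym cxx≡0) (0<c*x*x 0<c x≢0))

nonNegative-+≡0 : ∀ {p q} → 0ℚ ℚ.≤ p → 0ℚ ℚ.≤ q → p + q ≡ 0ℚ → p ≡ 0ℚ × q ≡ 0ℚ
nonNegative-+≡0 {p} {q} 0≤p 0≤q p+q≡0 =
  ℚP.≤-antisym (subst₂ ℚ._≤_ (ℚP.+-identityʳ p) p+q≡0 (ℚP.+-mono-≤ (ℚP.≤-refl {p}) 0≤q)) 0≤p ,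
  ℚP.≤-antisym (subst₂ ℚ._≤_ (ℚP.+-identityˡ q) p+q≡0 (ℚP.+-mono-≤ 0≤p (ℚP.≤-refl {q}))) 0≤q

0≤p-q⇒q≤p : ∀ {p q} → 0ℚ ℚ.≤ p + - q → q ℚ.≤ p
0≤p-q⇒q≤p {p} {q} 0≤p-q = subst₂ ℚ._≤_ (ℚP.+-identityˡ q) (x-y+y≡x p q) (ℚP.+-monoˡ-≤ q 0≤p-q)

square≤⇒≤1 : ∀ m → ℕ→ℚ m * ℕ→ℚ m ℚ.≤ ℕ→ℚ m → m ℕ.≤ 1
square≤⇒≤1 ℕ.zero    _    = ℕ.z≤n
square≤⇒≤1 (ℕ.suc m) m²≤m = ℕP.*-cancelʳ-≤ (ℕ.suc m) 1 (ℕ.suc m)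
  (subst (ℕ.suc m ℕ.* ℕ.suc m ℕ.≤_) (sym (ℕP.*-identityˡ (ℕ.suc m)))
         (ℤP.drop‿+≤+ (ℤ→ℚ-cancel-≤ (subst (ℚ._≤ ℕ→ℚ (ℕ.suc m)) (sym (ℕ→ℚ-homo-* (ℕ.suc m) (ℕ.suc m))) m²≤m))))

4n+4t+1≡1⇒t≡-n : ∀ n t → twoℚ * twoℚ * n + (twoℚ * t + twoℚ * t) + 1ℚ ≡ 1ℚ → t ≡ - n
4n+4t+1≡1⇒t≡-n n t eq = begin
  t                                                                   ≡⟨ isolate n t ⟩
  - n + ½ * ½ * (twoℚ * twoℚ * n + (twoℚ * t + twoℚ * t) + 1ℚ + - 1ℚ)  ≡⟨ cong (λ r → - n + ½ * ½ * (r + - 1ℚ)) eq ⟩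
  - n + ½ * ½ * (1ℚ + - 1ℚ)                                           ≡⟨ simplify n ⟩
  - n                                                                 ∎
  where
  open ≡-Reasoning
  isolate : ∀ n t → t ≡ - n + ½ * ½ * (twoℚ * twoℚ * n + (twoℚ * t + twoℚ * t) + 1ℚ + - 1ℚ)
  isolate = solve 2 (λ n t →
    t := :- n :+ con ½ :* con ½ :* (con twoℚ :* con twoℚ :* n :+ (con twoℚ :* t :+ con twoℚ :* t) :+ con 1ℚ :+ :- con 1ℚ)) refl
  simplify : ∀ n → - n + ½ * ½ * (1ℚ + - 1ℚ) ≡ - n
  simplify = solve 1 (λ n → :- n :+ con ½ :* con ½ :* (con 1ℚ :+ :- con 1ℚ) := :- n) refl

sum≡0⇒≡0 : ∀ {n} (f : Fin n → ℕ) → sum f ≡ 0 → ∀ i → f i ≡ 0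
sum≡0⇒≡0 f Σf≡0 zero    = ℕP.m+n≡0⇒m≡0 (f zero) Σf≡0
sum≡0⇒≡0 f Σf≡0 (suc i) = sum≡0⇒≡0 (f ∘ suc) (ℕP.m+n≡0⇒n≡0 (f zero) Σf≡0) i

sum≡1⇒unique : ∀ {n} (f : Fin n → ℕ) → sum f ≡ 1 → ∃ λ k → f k ≡ 1 × ∀ i → i ≢ k → f i ≡ 0
sum≡1⇒unique {ℕ.zero}  f ()
sum≡1⇒unique {ℕ.suc n} f Σf≡1 with f zero in f₀≡
... | 0 with sum≡1⇒unique (f ∘ suc) Σf≡1
...   | k , fk≡1 , rest = suc k , fk≡1 , λ { zero _ → f₀≡ ; (suc i) i≢k → rest i (i≢k ∘ cong suc) }
sum≡1⇒unique {ℕ.suc n} f Σf≡1 | 1 = zero , f₀≡ , λ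
  { zero 0≢0 → ⊥-elim (0≢0 refl) ; (suc i) _ → sum≡0⇒≡0 (f ∘ suc) (ℕP.suc-injective Σf≡1) i }
sum≡1⇒unique {ℕ.suc n} f () | ℕ.suc (ℕ.suc _)

-- A value missed by an injective f would let f be squeezed into Fin n.
injective⇒surjective : ∀ {n} (f : Fin n → Fin n) → Injective _≡_ _≡_ f → ∀ y → ∃ λ x → f x ≡ y
injective⇒surjective {ℕ.suc n} f f-injective y with FinP.any? (λ x → f x FinP.≟ y)
... | yes hit = hit
... | no miss = ⊥-elim (ℕP.<-irrefl refl (FinP.injective⇒≤ squeezed-injective))
  where
  y≢f : ∀ x → y ≢ f x
  y≢f x y≡fx = miss (x , sym y≡fx)
  squeezed : Fin (ℕ.suc n) → Fin n
  squeezed x = punchOut (y≢f x)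
  squeezed-injective : Injective _≡_ _≡_ squeezed
  squeezed-injective {x} {z} eq = f-injective (FinP.punchOut-injective (y≢f x) (y≢f z) eq)

injective⇒permutation : ∀ {n} (f : Fin n → Fin n) → Injective _≡_ _≡_ f →
                        Σ (Permutation′ n) λ π → ∀ i → π ⟨$⟩ʳ i ≡ f i
injective⇒permutation {n} f f-injective =
  permutation f f⁻¹ (λ y → proj₂ (surjective y)) (λ x → f-injective (proj₂ (surjective (f x)))) , λ _ → refl
  where
  surjective : ∀ y → ∃ λ x → f x ≡ y
  surjective = injective⇒surjective f f-injective
  f⁻¹ : Fin n → Fin n
  f⁻¹ y = proj₁ (surjective y)

-- A rational with bounded denominators of its powers is an integer

coprime-*ˡ : ∀ {m n o} → ℕC.Coprime m o → ℕC.Coprime n o → ℕC.Coprime (m ℕ.* n) o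
coprime-*ˡ {m} {n} {o} m⊥o n⊥o {d} (d∣mn , d∣o) = n⊥o (d∣n , d∣o)
  where
  d⊥m : ℕC.Coprime d m
  d⊥m (e∣d , e∣m) = m⊥o (e∣m , ℕD.∣-trans e∣d d∣o)
  d∣n : d ℕD.∣ n
  d∣n = ℕC.coprime-divisor d⊥m d∣mn

coprime-^ˡ : ∀ {m n} k → ℕC.Coprime m n → ℕC.Coprime (m ℕ.^ k) n
coprime-^ˡ ℕ.zero    m⊥n = ℕC.1-coprimeTo _
coprime-^ˡ (ℕ.suc k) m⊥n = coprime-*ˡ m⊥n (coprime-^ˡ k m⊥n)

coprime-divisor-^ : ∀ {m n o} k → ℕC.Coprime m n → m ℕD.∣ o ℕ.* n ℕ.^ k → m ℕD.∣ o
coprime-divisor-^ {m} {n} {o} ℕ.zero    m⊥n m∣o = subst (m ℕD.∣_) (ℕP.*-identityʳ o) m∣o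
coprime-divisor-^ {m} {n} {o} (ℕ.suc k) m⊥n m∣o*n*n^k = coprime-divisor-^ k m⊥n
  (ℕC.coprime-divisor m⊥n (subst (m ℕD.∣_) (x∙yz≈y∙xz o n (n ℕ.^ k)) m∣o*n*n^k))

n<2^n : ∀ n → n ℕ.< 2 ℕ.^ n
n<2^n ℕ.zero    = ℕ.s≤s ℕ.z≤n
n<2^n (ℕ.suc n) = ℕP.+-mono-≤ (ℕP.m^n>0 2 n) (ℕP.≤-trans (n<2^n n) (ℕP.m≤m+n _ 0))

^-self-∣⇒≤1 : ∀ {q n} .{{_ : NonZero n}} → q ℕ.^ n ℕD.∣ n → q ℕ.≤ 1
^-self-∣⇒≤1 {0}                 _      = ℕ.z≤n
^-self-∣⇒≤1 {1}                 _      = ℕP.≤-refl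
^-self-∣⇒≤1 {ℕ.suc (ℕ.suc q)} {n} q^n∣n = ⊥-elim (ℕP.<-irrefl refl (begin-strict
  n                      <⟨ n<2^n n ⟩
  2 ℕ.^ n                ≤⟨ ℕP.^-monoˡ-≤ n (ℕ.s≤s (ℕ.s≤s ℕ.z≤n)) ⟩
  ℕ.suc (ℕ.suc q) ℕ.^ n  ≤⟨ ℕD.∣⇒≤ q^n∣n ⟩
  n                      ∎))
  where open ℕP.≤-Reasoning

∣i^k∣≡∣i∣^k : ∀ i k → ℤ.∣ i ℤ.^ k ∣ ≡ ℤ.∣ i ∣ ℕ.^ k
∣i^k∣≡∣i∣^k i ℕ.zero    = refl
∣i^k∣≡∣i∣^k i (ℕ.suc k) = trans (ℤP.abs-* i (i ℤ.^ k)) (cong (ℤ.∣ i ∣ ℕ.*_) (∣i^k∣≡∣i∣^k i k))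

infixr 8 _^_
_^_ : ℚ → ℕ → ℚ
r ^ ℕ.zero  = 1ℚ
r ^ ℕ.suc k = r * r ^ k

↧*≡↥ : ∀ r → ℤ→ℚ (↧ r) * r ≡ ℤ→ℚ (↥ r)
↧*≡↥ r@(mkℚ p d _) = ℚP.toℚᵘ-injective (begin
  toℚᵘ (ℤ→ℚ (↧ r) * r)                ≈⟨ ℚP.toℚᵘ-homo-* (ℤ→ℚ (↧ r)) r ⟩
  toℚᵘ (ℤ→ℚ (↧ r)) ℚᵘ.* mkℚᵘ p d      ≈⟨ ℚᵘP.*-congʳ {mkℚᵘ p d} (toℚᵘ-ℤ→ℚ (↧ r)) ⟩
  mkℚᵘ (↧ r) 0 ℚᵘ.* mkℚᵘ p d          ≈⟨ *≡* cross-multiplied ⟩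
  mkℚᵘ p 0                            ≈⟨ toℚᵘ-ℤ→ℚ p ⟨
  toℚᵘ (ℤ→ℚ p)                        ∎)
  where
  open ℚᵘP.≃-Reasoning
  commuted : ∀ q p → (q ℤ.* p) ℤ.* + 1 ≡ p ℤ.* q
  commuted = solve-∀
  cross-multiplied : (↧ r ℤ.* p) ℤ.* + 1 ≡ p ℤ.* + (1 ℕ.* ↧ₙ r)
  cross-multiplied = trans (commuted (↧ r) p) (cong (λ n → p ℤ.* + n) (sym (ℕP.*-identityˡ (↧ₙ r))))

↧^*^≡↥^ : ∀ r k → ℤ→ℚ (↧ r ℤ.^ k) * r ^ k ≡ ℤ→ℚ (↥ r ℤ.^ k)
↧^*^≡↥^ r ℕ.zero    = refl
↧^*^≡↥^ r (ℕ.suc k) = begin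
  ℤ→ℚ (↧ r ℤ.* ↧ r ℤ.^ k) * (r * r ^ k)         ≡⟨ cong (_* (r * r ^ k)) (ℤ→ℚ-homo-* (↧ r) (↧ r ℤ.^ k)) ⟩
  ℤ→ℚ (↧ r) * ℤ→ℚ (↧ r ℤ.^ k) * (r * r ^ k)     ≡⟨ interchange (ℤ→ℚ (↧ r)) (ℤ→ℚ (↧ r ℤ.^ k)) r (r ^ k) ⟩
  ℤ→ℚ (↧ r) * r * (ℤ→ℚ (↧ r ℤ.^ k) * r ^ k)     ≡⟨ cong₂ _*_ (↧*≡↥ r) (↧^*^≡↥^ r k) ⟩
  ℤ→ℚ (↥ r) * ℤ→ℚ (↥ r ℤ.^ k)                   ≡⟨ ℤ→ℚ-homo-* (↥ r) (↥ r ℤ.^ k) ⟨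
  ℤ→ℚ (↥ r ℤ.* ↥ r ℤ.^ k)                       ∎
  where
  open ≡-Reasoning
  interchange : ∀ w x y z → w * x * (y * z) ≡ w * y * (x * z)
  interchange = solve 4 (λ w x y z → w :* x :* (y :* z) := w :* y :* (x :* z)) refl

↧^∣E*↥^ : ∀ E r k → IsInteger (ℕ→ℚ E * r ^ k) → ↧ₙ r ℕ.^ k ℕD.∣ E ℕ.* ℤ.∣ ↥ r ∣ ℕ.^ k
↧^∣E*↥^ E r k (z , E*r^k≡z) = ℕD.divides ℤ.∣ z ∣ (begin
  E ℕ.* ℤ.∣ ↥ r ∣ ℕ.^ k          ≡⟨ cong (E ℕ.*_) (∣i^k∣≡∣i∣^k (↥ r) k) ⟨
  E ℕ.* ℤ.∣ ↥ r ℤ.^ k ∣          ≡⟨ ℤP.abs-* (+ E) (↥ r ℤ.^ k) ⟨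
  ℤ.∣ + E ℤ.* ↥ r ℤ.^ k ∣        ≡⟨ cong ℤ.∣_∣ (ℤ→ℚ-injective {+ E ℤ.* ↥ r ℤ.^ k} {z ℤ.* ↧ r ℤ.^ k} cleared) ⟩
  ℤ.∣ z ℤ.* ↧ r ℤ.^ k ∣          ≡⟨ ℤP.abs-* z (↧ r ℤ.^ k) ⟩
  ℤ.∣ z ∣ ℕ.* ℤ.∣ ↧ r ℤ.^ k ∣    ≡⟨ cong (ℤ.∣ z ∣ ℕ.*_) (∣i^k∣≡∣i∣^k (↧ r) k) ⟩
  ℤ.∣ z ∣ ℕ.* ↧ₙ r ℕ.^ k         ∎)
  where
  open ≡-Reasoning
  cleared : ℤ→ℚ (+ E ℤ.* ↥ r ℤ.^ k) ≡ ℤ→ℚ (z ℤ.* ↧ r ℤ.^ k)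
  cleared = begin
    ℤ→ℚ (+ E ℤ.* ↥ r ℤ.^ k)             ≡⟨ ℤ→ℚ-homo-* (+ E) (↥ r ℤ.^ k) ⟩
    ℕ→ℚ E * ℤ→ℚ (↥ r ℤ.^ k)             ≡⟨ cong (ℕ→ℚ E *_) (↧^*^≡↥^ r k) ⟨
    ℕ→ℚ E * (ℤ→ℚ (↧ r ℤ.^ k) * r ^ k)   ≡⟨ x*yz≡y*xz (ℕ→ℚ E) (ℤ→ℚ (↧ r ℤ.^ k)) (r ^ k) ⟩
    ℤ→ℚ (↧ r ℤ.^ k) * (ℕ→ℚ E * r ^ k)   ≡⟨ cong (ℤ→ℚ (↧ r ℤ.^ k) *_) E*r^k≡z ⟩
    ℤ→ℚ (↧ r ℤ.^ k) * ℤ→ℚ z             ≡⟨ ℤ→ℚ-homo-* (↧ r ℤ.^ k) z ⟨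
    ℤ→ℚ (↧ r ℤ.^ k ℤ.* z)               ≡⟨ cong ℤ→ℚ (ℤP.*-comm (↧ r ℤ.^ k) z) ⟩
    ℤ→ℚ (z ℤ.* ↧ r ℤ.^ k)               ∎

-- With k = E, coprimality turns (↧ r)ᵏ ∣ E (↥ r)ᵏ into (↧ r)ᴱ ∣ E, which forces ↧ r = 1.
bounded-denominators⇒integer : ∀ E .{{_ : NonZero E}} r →
                               (∀ k → IsInteger (ℕ→ℚ E * r ^ k)) → IsInteger r
bounded-denominators⇒integer E r@(mkℚ _ _ ↥⊥↧) bounded = ↥ r , (begin
  r                ≡⟨ ℚP.*-identityˡ r ⟨
  1ℚ * r           ≡⟨ cong (λ d → ℤ→ℚ d * r) ↧r≡1 ⟨
  ℤ→ℚ (↧ r) * r    ≡⟨ ↧*≡↥ r ⟩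
  ℤ→ℚ (↥ r)        ∎)
  where
  open ≡-Reasoning
  ↧⊥↥ : ℕC.Coprime (↧ₙ r) ℤ.∣ ↥ r ∣
  ↧⊥↥ = ℕC.sym (ℕC.recompute ↥⊥↧)
  ↧ₙr≤1 : ↧ₙ r ℕ.≤ 1
  ↧ₙr≤1 = ^-self-∣⇒≤1 (coprime-divisor-^ E (coprime-^ˡ E ↧⊥↥) (↧^∣E*↥^ E r E (bounded E)))
  ↧r≡1 : ↧ r ≡ + 1
  ↧r≡1 = cong +_ (ℕP.≤-antisym ↧ₙr≤1 (ℕ.s≤s ℕ.z≤n))

-- Quaternion arithmetic

quat-cong : ∀ {x0 x1 x2 x3 y0 y1 y2 y3} → x0 ≡ y0 → x1 ≡ y1 → x2 ≡ y2 → x3 ≡ y3 →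
            quat x0 x1 x2 x3 ≡ quat y0 y1 y2 y3
quat-cong refl refl refl refl = refl

⊕-identityˡ : ∀ x → zeroQ ⊕ x ≡ x
⊕-identityˡ (quat x0 x1 x2 x3) = quat-cong (ℚP.+-identityˡ x0) (ℚP.+-identityˡ x1) (ℚP.+-identityˡ x2) (ℚP.+-identityˡ x3)

⊕-identityʳ : ∀ x → x ⊕ zeroQ ≡ x
⊕-identityʳ (quat x0 x1 x2 x3) = quat-cong (ℚP.+-identityʳ x0) (ℚP.+-identityʳ x1) (ℚP.+-identityʳ x2) (ℚP.+-identityʳ x3)

⊕-interchange : ∀ w x y z → (w ⊕ x) ⊕ (y ⊕ z) ≡ (w ⊕ y) ⊕ (x ⊕ z)
⊕-interchange (quat w0 w1 w2 w3) (quat x0 x1 x2 x3) (quat y0 y1 y2 y3) (quat z0 z1 z2 z3) =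
  quat-cong (interchange w0 x0 y0 z0) (interchange w1 x1 y1 z1) (interchange w2 x2 y2 z2) (interchange w3 x3 y3 z3)
  where
  interchange : ∀ w x y z → (w + x) + (y + z) ≡ (w + y) + (x + z)
  interchange = solve 4 (λ w x y z → (w :+ x) :+ (y :+ z) := (w :+ y) :+ (x :+ z)) refl

⊖⊕-cancelʳ : ∀ x y → x ⊕ ⊖ y ⊕ y ≡ x
⊖⊕-cancelʳ (quat x0 x1 x2 x3) (quat y0 y1 y2 y3) = quat-cong (x-y+y≡x x0 y0) (x-y+y≡x x1 y1) (x-y+y≡x x2 y2) (x-y+y≡x x3 y3)

·-distribˡ-⊕ : ∀ c x y → c · (x ⊕ y) ≡ c · x ⊕ c · y
·-distribˡ-⊕ c (quat x0 x1 x2 x3) (quat y0 y1 y2 y3) =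
  quat-cong (ℚP.*-distribˡ-+ c x0 y0) (ℚP.*-distribˡ-+ c x1 y1) (ℚP.*-distribˡ-+ c x2 y2) (ℚP.*-distribˡ-+ c x3 y3)

·-distribʳ-+ : ∀ c d x → (c + d) · x ≡ c · x ⊕ d · x
·-distribʳ-+ c d (quat x0 x1 x2 x3) =
  quat-cong (ℚP.*-distribʳ-+ x0 c d) (ℚP.*-distribʳ-+ x1 c d) (ℚP.*-distribʳ-+ x2 c d) (ℚP.*-distribʳ-+ x3 c d)

·-zeroʳ : ∀ c → c · zeroQ ≡ zeroQ
·-zeroʳ c = quat-cong (ℚP.*-zeroʳ c) (ℚP.*-zeroʳ c) (ℚP.*-zeroʳ c) (ℚP.*-zeroʳ c)

·-assoc : ∀ c d x → c · (d · x) ≡ (c * d) · x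
·-assoc c d (quat x0 x1 x2 x3) =
  quat-cong (sym (ℚP.*-assoc c d x0)) (sym (ℚP.*-assoc c d x1)) (sym (ℚP.*-assoc c d x2)) (sym (ℚP.*-assoc c d x3))

·-comm : ∀ c d x → c · (d · x) ≡ d · (c · x)
·-comm c d (quat x0 x1 x2 x3) = quat-cong (x*yz≡y*xz c d x0) (x*yz≡y*xz c d x1) (x*yz≡y*xz c d x2) (x*yz≡y*xz c d x3)

⊖≡-1· : ∀ x → ⊖ x ≡ (- 1ℚ) · x
⊖≡-1· (quat x0 x1 x2 x3) = quat-cong (-x≡-1*x x0) (-x≡-1*x x1) (-x≡-1*x x2) (-x≡-1*x x3)
  where
  -x≡-1*x : ∀ x → - x ≡ - 1ℚ * x
  -x≡-1*x = solve 1 (λ x → :- x := :- con 1ℚ :* x) refl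

sumFin-cong : ∀ {n} {f g : Fin n → Quat} → (∀ i → f i ≡ g i) → sumFin f ≡ sumFin g
sumFin-cong {ℕ.zero}  f≗g = refl
sumFin-cong {ℕ.suc n} f≗g = cong₂ _⊕_ (f≗g zero) (sumFin-cong (f≗g ∘ suc))

sumFin-⊕ : ∀ {n} (f g : Fin n → Quat) → sumFin f ⊕ sumFin g ≡ sumFin (λ i → f i ⊕ g i)
sumFin-⊕ {ℕ.zero}  f g = refl
sumFin-⊕ {ℕ.suc n} f g = trans (⊕-interchange (f zero) (sumFin (f ∘ suc)) (g zero) (sumFin (g ∘ suc)))
                               (cong (f zero ⊕ g zero ⊕_) (sumFin-⊕ (f ∘ suc) (g ∘ suc)))

sumFin-· : ∀ {n} c (f : Fin n → Quat) → c · sumFin f ≡ sumFin (λ i → c · f i)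
sumFin-· {ℕ.zero}  c f = ·-zeroʳ c
sumFin-· {ℕ.suc n} c f = trans (·-distribˡ-⊕ c (f zero) (sumFin (f ∘ suc)))
                               (cong (c · f zero ⊕_) (sumFin-· c (f ∘ suc)))

sumFin-zero : ∀ {n} (f : Fin n → Quat) → (∀ i → f i ≡ zeroQ) → sumFin f ≡ zeroQ
sumFin-zero {ℕ.zero}  f f≡0 = refl
sumFin-zero {ℕ.suc n} f f≡0 = trans (cong₂ _⊕_ (f≡0 zero) (sumFin-zero (f ∘ suc) (f≡0 ∘ suc))) (⊕-identityˡ zeroQ)

sumFin-single : ∀ {n} (f : Fin n → Quat) k → (∀ i → i ≢ k → f i ≡ zeroQ) → sumFin f ≡ f k
sumFin-single f zero    f≡0 = trans (cong (f zero ⊕_) (sumFin-zero (f ∘ suc) (λ i → f≡0 (suc i) λ ())))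
                                    (⊕-identityʳ (f zero))
sumFin-single f (suc k) f≡0 =
  trans (cong₂ _⊕_ (f≡0 zero λ ()) (sumFin-single (f ∘ suc) k (λ i i≢k → f≡0 (suc i) (i≢k ∘ FinP.suc-injective))))
        (⊕-identityˡ (f (suc k)))

q0-sumFin : ∀ {n} (f : Fin n → Quat) (m : Fin n → ℕ) → (∀ i → q0 (f i) ≡ ℕ→ℚ (m i)) →
            q0 (sumFin f) ≡ ℕ→ℚ (sum m)
q0-sumFin {ℕ.zero}  f m q0f≡m = refl
q0-sumFin {ℕ.suc n} f m q0f≡m = trans (cong₂ _+_ (q0f≡m zero) (q0-sumFin (f ∘ suc) (m ∘ suc) (q0f≡m ∘ suc)))
                                      (sym (ℕ→ℚ-homo-+ (m zero) (sum (m ∘ suc))))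

coord : Quat → Fin 4 → ℚ
coord x zero                   = q0 x
coord x (suc zero)             = q1 x
coord x (suc (suc zero))       = q2 x
coord x (suc (suc (suc zero))) = q3 x

coord-⊕ : ∀ x y i → coord (x ⊕ y) i ≡ coord x i + coord y i
coord-⊕ x y zero                   = refl
coord-⊕ x y (suc zero)             = refl
coord-⊕ x y (suc (suc zero))       = refl
coord-⊕ x y (suc (suc (suc zero))) = refl

coord-· : ∀ c x i → coord (c · x) i ≡ c * coord x i
coord-· c x zero                   = refl
coord-· c x (suc zero)             = refl
coord-· c x (suc (suc zero))       = refl
coord-· c x (suc (suc (suc zero))) = refl

IsIntegral : Quat → Set
IsIntegral x = ∀ i → IsInteger (coord x i)

IsIntegral-zeroQ : IsIntegral zeroQ
IsIntegral-zeroQ zero                   = + 0 , refl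
IsIntegral-zeroQ (suc zero)             = + 0 , refl
IsIntegral-zeroQ (suc (suc zero))       = + 0 , refl
IsIntegral-zeroQ (suc (suc (suc zero))) = + 0 , refl

IsIntegral-⊕ : ∀ {x y} → IsIntegral x → IsIntegral y → IsIntegral (x ⊕ y)
IsIntegral-⊕ {x} {y} x∈ℤ⁴ y∈ℤ⁴ i = subst IsInteger (sym (coord-⊕ x y i)) (IsInteger-+ (x∈ℤ⁴ i) (y∈ℤ⁴ i))

IsIntegral-· : ∀ z {x} → IsIntegral x → IsIntegral (ℤ→ℚ z · x)
IsIntegral-· z {x} x∈ℤ⁴ i = subst IsInteger (sym (coord-· (ℤ→ℚ z) x i)) (IsInteger-* (IsInteger-ℤ→ℚ z) (x∈ℤ⁴ i))

IsIntegral-sumFin : ∀ {n} (f : Fin n → Quat) → (∀ i → IsIntegral (f i)) → IsIntegral (sumFin f)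
IsIntegral-sumFin {ℕ.zero}  f f∈ℤ⁴ = IsIntegral-zeroQ
IsIntegral-sumFin {ℕ.suc n} f f∈ℤ⁴ = IsIntegral-⊕ (f∈ℤ⁴ zero) (IsIntegral-sumFin (f ∘ suc) (f∈ℤ⁴ ∘ suc))

_Clears_ : ℕ → Quat → Set
d Clears x = ∀ i → IsInteger (ℕ→ℚ d * coord x i)

Clears⇒IsIntegral : ∀ {d x} → d Clears x → IsIntegral (ℕ→ℚ d · x)
Clears⇒IsIntegral {d} {x} d-clears i = subst IsInteger (sym (coord-· (ℕ→ℚ d) x i)) (d-clears i)

∣-clears : ∀ {d e} r → d ℕD.∣ e → IsInteger (ℕ→ℚ d * r) → IsInteger (ℕ→ℚ e * r)
∣-clears {d} r (ℕD.divides q refl) d*r∈ℤ = subst IsInteger (begin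
  ℕ→ℚ q * (ℕ→ℚ d * r)    ≡⟨ ℚP.*-assoc (ℕ→ℚ q) (ℕ→ℚ d) r ⟨
  ℕ→ℚ q * ℕ→ℚ d * r      ≡⟨ cong (_* r) (ℕ→ℚ-homo-* q d) ⟨
  ℕ→ℚ (q ℕ.* d) * r      ∎) (IsInteger-* (IsInteger-ℤ→ℚ (+ q)) d*r∈ℤ)
  where open ≡-Reasoning

common-multiple : ∀ {n} (P : ℕ → Fin n → Set) → (∀ {d e} i → d ℕD.∣ e → P d i → P e i) →
                  (∀ i → ∃ λ d → NonZero d × P d i) → ∃ λ d → NonZero d × ∀ i → P d i
common-multiple {ℕ.zero}  P ∣-closed exists = 1 , _ , λ ()
common-multiple {ℕ.suc n} P ∣-closed exists
  with exists zero | common-multiple (λ d i → P d (suc i)) (∣-closed ∘ suc) (exists ∘ suc)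
... | d₀ , d₀≢0 , Pd₀ | d , d≢0 , Pd = d₀ ℕ.* d , ℕP.m*n≢0 d₀ d {{d₀≢0}} {{d≢0}} , λ
  { zero    → ∣-closed zero (ℕD.m∣m*n d) Pd₀
  ; (suc i) → ∣-closed (suc i) (ℕD.n∣m*n d₀) (Pd i) }

denominator-exists : ∀ x → ∃ λ d → NonZero d × d Clears x
denominator-exists x = common-multiple (λ d i → IsInteger (ℕ→ℚ d * coord x i))
  (λ i → ∣-clears (coord x i)) (λ i → ↧ₙ coord x i , _ , ↥ (coord x i) , ↧*≡↥ (coord x i))

idMat-diag : ∀ {n} (i : Fin n) → idMat i i ≡ oneQ
idMat-diag i with i FinP.≟ i
... | yes _  = refl
... | no i≢i = ⊥-elim (i≢i refl)

idMat-off : ∀ {n} {i j : Fin n} → i ≢ j → idMat i j ≡ zeroQ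
idMat-off {i = i} {j} i≢j with i FinP.≟ j
... | yes i≡j = ⊥-elim (i≢j i≡j)
... | no _    = refl

IsMonomial : (Quat → Set) → ∀ {n} → Mat n → Set
IsMonomial P {n} A = Σ (Permutation′ n) λ σ →
  ∀ i j → (j ≡ σ ⟨$⟩ʳ i → P (A i j)) × (j ≢ σ ⟨$⟩ʳ i → A i j ≡ zeroQ)

IsMonomial-map : ∀ {P Q : Quat → Set} {n} {A : Mat n} → (∀ {i j} → P (A i j) → Q (A i j)) →
                 IsMonomial P A → IsMonomial Q A
IsMonomial-map P⇒Q (σ , entries) = σ , λ i j → P⇒Q ∘ proj₁ (entries i j) , proj₂ (entries i j)

-- Copies of the quaternion operations of Defs on polynomial expressions.  Their semantics ⟦_⟧
-- unfolds to the operations of Defs, so solve proves quaternion identities coordinatewise.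

record Quatᴱ (m : ℕ) : Set where
  constructor quatᴱ
  field e0 e1 e2 e3 : Polynomial m
open Quatᴱ

module _ {m : ℕ} where

  _⊕ᴱ_ : Quatᴱ m → Quatᴱ m → Quatᴱ m
  quatᴱ x0 x1 x2 x3 ⊕ᴱ quatᴱ y0 y1 y2 y3 = quatᴱ (x0 :+ y0) (x1 :+ y1) (x2 :+ y2) (x3 :+ y3)

  ⊖ᴱ_ : Quatᴱ m → Quatᴱ m
  ⊖ᴱ quatᴱ x0 x1 x2 x3 = quatᴱ (:- x0) (:- x1) (:- x2) (:- x3)

  _·ᴱ_ : Polynomial m → Quatᴱ m → Quatᴱ m
  c ·ᴱ quatᴱ x0 x1 x2 x3 = quatᴱ (c :* x0) (c :* x1) (c :* x2) (c :* x3)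

  zeroᴱ oneᴱ : Quatᴱ m
  zeroᴱ = quatᴱ (con 0ℚ) (con 0ℚ) (con 0ℚ) (con 0ℚ)
  oneᴱ  = quatᴱ (con 1ℚ) (con 0ℚ) (con 0ℚ) (con 0ℚ)

  mulᴱ : Polynomial m → Polynomial m → Quatᴱ m → Quatᴱ m → Quatᴱ m
  mulᴱ a b (quatᴱ x0 x1 x2 x3) (quatᴱ y0 y1 y2 y3) = quatᴱ
    (x0 :* y0 :+ a :* (x1 :* y1) :+ b :* (x2 :* y2) :+ (:- (a :* b)) :* (x3 :* y3))
    (x0 :* y1 :+ x1 :* y0 :+ (:- b) :* (x2 :* y3) :+ b :* (x3 :* y2))
    (x0 :* y2 :+ x2 :* y0 :+ a :* (x1 :* y3) :+ (:- a) :* (x3 :* y1))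
    (x0 :* y3 :+ x3 :* y0 :+ x1 :* y2 :+ :- (x2 :* y1))

  conjᴱ : Quatᴱ m → Quatᴱ m
  conjᴱ (quatᴱ x0 x1 x2 x3) = quatᴱ x0 (:- x1) (:- x2) (:- x3)

  Nᴱ : Polynomial m → Polynomial m → Quatᴱ m → Polynomial m
  Nᴱ a b x = e0 (mulᴱ a b x (conjᴱ x))

module QuaternionAlgebra (a b : ℚ) where

  infixl 7 _∙_
  _∙_ : Quat → Quat → Quat
  _∙_ = mulQ a b

  N : Quat → ℚ
  N x = q0 (x ∙ conj x)

  N-∙ : ∀ x y → N (x ∙ y) ≡ N x * N y
  N-∙ (quat x0 x1 x2 x3) (quat y0 y1 y2 y3) = solve 10 (λ a b x0 x1 x2 x3 y0 y1 y2 y3 →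
    let x = quatᴱ x0 x1 x2 x3; y = quatᴱ y0 y1 y2 y3 in Nᴱ a b (mulᴱ a b x y) := Nᴱ a b x :* Nᴱ a b y)
    refl a b x0 x1 x2 x3 y0 y1 y2 y3

  ∙-conj : ∀ x → x ∙ conj x ≡ N x · oneQ
  ∙-conj (quat x0 x1 x2 x3) = quat-cong
    (solve 6 (λ a b x0 x1 x2 x3 → let x = quatᴱ x0 x1 x2 x3 in e0 (mulᴱ a b x (conjᴱ x)) := e0 (Nᴱ a b x ·ᴱ oneᴱ))
       refl a b x0 x1 x2 x3)
    (solve 6 (λ a b x0 x1 x2 x3 → let x = quatᴱ x0 x1 x2 x3 in e1 (mulᴱ a b x (conjᴱ x)) := e1 (Nᴱ a b x ·ᴱ oneᴱ))
       refl a b x0 x1 x2 x3)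
    (solve 6 (λ a b x0 x1 x2 x3 → let x = quatᴱ x0 x1 x2 x3 in e2 (mulᴱ a b x (conjᴱ x)) := e2 (Nᴱ a b x ·ᴱ oneᴱ))
       refl a b x0 x1 x2 x3)
    (solve 6 (λ a b x0 x1 x2 x3 → let x = quatᴱ x0 x1 x2 x3 in e3 (mulᴱ a b x (conjᴱ x)) := e3 (Nᴱ a b x ·ᴱ oneᴱ))
       refl a b x0 x1 x2 x3)

  conj-∙ : ∀ x → conj x ∙ x ≡ N x · oneQ
  conj-∙ (quat x0 x1 x2 x3) = quat-cong
    (solve 6 (λ a b x0 x1 x2 x3 → let x = quatᴱ x0 x1 x2 x3 in e0 (mulᴱ a b (conjᴱ x) x) := e0 (Nᴱ a b x ·ᴱ oneᴱ))
       refl a b x0 x1 x2 x3)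
    (solve 6 (λ a b x0 x1 x2 x3 → let x = quatᴱ x0 x1 x2 x3 in e1 (mulᴱ a b (conjᴱ x) x) := e1 (Nᴱ a b x ·ᴱ oneᴱ))
       refl a b x0 x1 x2 x3)
    (solve 6 (λ a b x0 x1 x2 x3 → let x = quatᴱ x0 x1 x2 x3 in e2 (mulᴱ a b (conjᴱ x) x) := e2 (Nᴱ a b x ·ᴱ oneᴱ))
       refl a b x0 x1 x2 x3)
    (solve 6 (λ a b x0 x1 x2 x3 → let x = quatᴱ x0 x1 x2 x3 in e3 (mulᴱ a b (conjᴱ x) x) := e3 (Nᴱ a b x ·ᴱ oneᴱ))
       refl a b x0 x1 x2 x3)

  ∙-zeroˡ : ∀ x → zeroQ ∙ x ≡ zeroQ
  ∙-zeroˡ (quat x0 x1 x2 x3) = quat-cong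
    (solve 6 (λ a b x0 x1 x2 x3 → let x = quatᴱ x0 x1 x2 x3 in e0 (mulᴱ a b zeroᴱ x) := con 0ℚ) refl a b x0 x1 x2 x3)
    (solve 6 (λ a b x0 x1 x2 x3 → let x = quatᴱ x0 x1 x2 x3 in e1 (mulᴱ a b zeroᴱ x) := con 0ℚ) refl a b x0 x1 x2 x3)
    (solve 6 (λ a b x0 x1 x2 x3 → let x = quatᴱ x0 x1 x2 x3 in e2 (mulᴱ a b zeroᴱ x) := con 0ℚ) refl a b x0 x1 x2 x3)
    (solve 6 (λ a b x0 x1 x2 x3 → let x = quatᴱ x0 x1 x2 x3 in e3 (mulᴱ a b zeroᴱ x) := con 0ℚ) refl a b x0 x1 x2 x3)

  ∙-zeroʳ : ∀ x → x ∙ zeroQ ≡ zeroQ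
  ∙-zeroʳ (quat x0 x1 x2 x3) = quat-cong
    (solve 6 (λ a b x0 x1 x2 x3 → let x = quatᴱ x0 x1 x2 x3 in e0 (mulᴱ a b x zeroᴱ) := con 0ℚ) refl a b x0 x1 x2 x3)
    (solve 6 (λ a b x0 x1 x2 x3 → let x = quatᴱ x0 x1 x2 x3 in e1 (mulᴱ a b x zeroᴱ) := con 0ℚ) refl a b x0 x1 x2 x3)
    (solve 6 (λ a b x0 x1 x2 x3 → let x = quatᴱ x0 x1 x2 x3 in e2 (mulᴱ a b x zeroᴱ) := con 0ℚ) refl a b x0 x1 x2 x3)
    (solve 6 (λ a b x0 x1 x2 x3 → let x = quatᴱ x0 x1 x2 x3 in e3 (mulᴱ a b x zeroᴱ) := con 0ℚ) refl a b x0 x1 x2 x3)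

  N-zeroQ : N zeroQ ≡ 0ℚ
  N-zeroQ = solve 2 (λ a b → Nᴱ a b zeroᴱ := con 0ℚ) refl a b

  N-oneQ : N oneQ ≡ 1ℚ
  N-oneQ = solve 2 (λ a b → Nᴱ a b oneᴱ := con 1ℚ) refl a b

  N-⊖ : ∀ x → N (⊖ x) ≡ N x
  N-⊖ (quat x0 x1 x2 x3) = solve 6 (λ a b x0 x1 x2 x3 → let x = quatᴱ x0 x1 x2 x3 in Nᴱ a b (⊖ᴱ x) := Nᴱ a b x)
    refl a b x0 x1 x2 x3

  N-conj : ∀ x → N (conj x) ≡ N x
  N-conj (quat x0 x1 x2 x3) = solve 6 (λ a b x0 x1 x2 x3 → let x = quatᴱ x0 x1 x2 x3 in Nᴱ a b (conjᴱ x) := Nᴱ a b x)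
    refl a b x0 x1 x2 x3

  N-· : ∀ c x → N (c · x) ≡ c * c * N x
  N-· c (quat x0 x1 x2 x3) = solve 7 (λ a b c x0 x1 x2 x3 → let x = quatᴱ x0 x1 x2 x3 in
    Nᴱ a b (c ·ᴱ x) := c :* c :* Nᴱ a b x) refl a b c x0 x1 x2 x3

  N-⊕oneQ : ∀ x → N (x ⊕ oneQ) ≡ N x + (q0 x + q0 x) + 1ℚ
  N-⊕oneQ (quat x0 x1 x2 x3) = solve 6 (λ a b x0 x1 x2 x3 → let x = quatᴱ x0 x1 x2 x3 in
    Nᴱ a b (x ⊕ᴱ oneᴱ) := Nᴱ a b x :+ (x0 :+ x0) :+ con 1ℚ) refl a b x0 x1 x2 x3

  conj≡trace·oneQ⊖ : ∀ x → conj x ≡ (q0 x + q0 x) · oneQ ⊕ ⊖ x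
  conj≡trace·oneQ⊖ (quat x0 x1 x2 x3) = quat-cong (real x0) (imaginary x0 x1) (imaginary x0 x2) (imaginary x0 x3)
    where
    real : ∀ x0 → x0 ≡ (x0 + x0) * 1ℚ + - x0
    real = solve 1 (λ x0 → x0 := (x0 :+ x0) :* con 1ℚ :+ :- x0) refl
    imaginary : ∀ x0 x → - x ≡ (x0 + x0) * 0ℚ + - x
    imaginary = solve 2 (λ x0 x → :- x := (x0 :+ x0) :* con 0ℚ :+ :- x) refl

  vectorPart : Quat → Quat
  vectorPart x = quat 0ℚ (q1 x) (q2 x) (q3 x)

  N≡q0²+N-vectorPart : ∀ x → N x ≡ q0 x * q0 x + N (vectorPart x)
  N≡q0²+N-vectorPart (quat x0 x1 x2 x3) = solve 6 (λ a b x0 x1 x2 x3 →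
    Nᴱ a b (quatᴱ x0 x1 x2 x3) := x0 :* x0 :+ Nᴱ a b (quatᴱ (con 0ℚ) x1 x2 x3)) refl a b x0 x1 x2 x3

  N≡sum-of-squares : ∀ x → N x ≡ 1ℚ * (q0 x * q0 x) + (- a) * (q1 x * q1 x) + (- b) * (q2 x * q2 x) + a * b * (q3 x * q3 x)
  N≡sum-of-squares (quat x0 x1 x2 x3) = solve 6 (λ a b x0 x1 x2 x3 →
    Nᴱ a b (quatᴱ x0 x1 x2 x3) := con 1ℚ :* (x0 :* x0) :+ (:- a) :* (x1 :* x1) :+ (:- b) :* (x2 :* x2) :+ a :* b :* (x3 :* x3))
    refl a b x0 x1 x2 x3

  infixr 8 _∙^_
  _∙^_ : Quat → ℕ → Quat
  x ∙^ ℕ.zero  = oneQ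
  x ∙^ ℕ.suc k = x ∙ x ∙^ k

  N-∙^ : ∀ x k → N (x ∙^ k) ≡ N x ^ k
  N-∙^ x ℕ.zero    = N-oneQ
  N-∙^ x (ℕ.suc k) = trans (N-∙ x (x ∙^ k)) (cong (N x *_) (N-∙^ x k))

  IsIntegral⇒↧a↧b*N-integer : ∀ {y} → IsIntegral y → IsInteger (ℕ→ℚ (↧ₙ a ℕ.* ↧ₙ b) * N y)
  IsIntegral⇒↧a↧b*N-integer {y} y∈ℤ⁴ = subst IsInteger (sym (begin
      ℕ→ℚ (↧ₙ a ℕ.* ↧ₙ b) * N y  ≡⟨ cong (_* N y) (ℕ→ℚ-homo-* (↧ₙ a) (↧ₙ b)) ⟩
      A * B * N y                ≡⟨ expanded A B y ⟩
      _                          ∎))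
    (IsInteger-+ (IsInteger-+ (IsInteger-+ (IsInteger-* (IsInteger-* A∈ℤ B∈ℤ) (square zero))
                                          (IsInteger-neg (IsInteger-* (IsInteger-* Aa∈ℤ B∈ℤ) (square (suc zero)))))
                             (IsInteger-neg (IsInteger-* (IsInteger-* Bb∈ℤ A∈ℤ) (square (suc (suc zero))))))
                (IsInteger-* (IsInteger-* Aa∈ℤ Bb∈ℤ) (square (suc (suc (suc zero))))))
    where
    open ≡-Reasoning
    A B : ℚ
    A = ℤ→ℚ (↧ a)
    B = ℤ→ℚ (↧ b)
    A∈ℤ : IsInteger A
    A∈ℤ = IsInteger-ℤ→ℚ (↧ a)
    B∈ℤ : IsInteger B
    B∈ℤ = IsInteger-ℤ→ℚ (↧ b)
    Aa∈ℤ : IsInteger (A * a)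
    Aa∈ℤ = ↥ a , ↧*≡↥ a
    Bb∈ℤ : IsInteger (B * b)
    Bb∈ℤ = ↥ b , ↧*≡↥ b
    square : ∀ i → IsInteger (coord y i * coord y i)
    square i = IsInteger-* (y∈ℤ⁴ i) (y∈ℤ⁴ i)
    expanded : ∀ A B y → A * B * N y ≡
      A * B * (q0 y * q0 y) + - (A * a * B * (q1 y * q1 y)) + - (B * b * A * (q2 y * q2 y)) + A * a * (B * b) * (q3 y * q3 y)
    expanded A B (quat y0 y1 y2 y3) = solve 8 (λ a b A B y0 y1 y2 y3 →
      A :* B :* Nᴱ a b (quatᴱ y0 y1 y2 y3) := A :* B :* (y0 :* y0) :+ :- (A :* a :* B :* (y1 :* y1))
                                              :+ :- (B :* b :* A :* (y2 :* y2)) :+ A :* a :* (B :* b) :* (y3 :* y3))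
      refl a b A B y0 y1 y2 y3

  monomial⇒unitary : ∀ {n} {A : Mat n} → IsMonomial (λ x → N x ≡ 1ℚ) A → IsUnitary a b A
  monomial⇒unitary {A = A} (σ , entries) i j = begin
    sumFin (λ k → A i k ∙ conj (A j k))    ≡⟨ sumFin-single (λ k → A i k ∙ conj (A j k)) (σ ⟨$⟩ʳ i) off-σ ⟩
    A i (σ ⟨$⟩ʳ i) ∙ conj (A j (σ ⟨$⟩ʳ i))  ≡⟨ on-σ (i FinP.≟ j) ⟩
    idMat i j                              ∎
    where
    open ≡-Reasoning
    off-σ : ∀ k → k ≢ σ ⟨$⟩ʳ i → A i k ∙ conj (A j k) ≡ zeroQ
    off-σ k k≢σi = trans (cong (λ x → x ∙ conj (A j k)) (proj₂ (entries i k) k≢σi)) (∙-zeroˡ (conj (A j k)))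
    on-σ : Dec (i ≡ j) → A i (σ ⟨$⟩ʳ i) ∙ conj (A j (σ ⟨$⟩ʳ i)) ≡ idMat i j
    on-σ (yes refl) = begin
      A i (σ ⟨$⟩ʳ i) ∙ conj (A i (σ ⟨$⟩ʳ i))  ≡⟨ ∙-conj (A i (σ ⟨$⟩ʳ i)) ⟩
      N (A i (σ ⟨$⟩ʳ i)) · oneQ               ≡⟨ cong (_· oneQ) (proj₁ (entries i (σ ⟨$⟩ʳ i)) refl) ⟩
      1ℚ · oneQ                               ≡⟨ idMat-diag i ⟨
      idMat i i                               ∎
    on-σ (no i≢j) = begin
      A i (σ ⟨$⟩ʳ i) ∙ conj (A j (σ ⟨$⟩ʳ i))  ≡⟨ cong (λ x → A i (σ ⟨$⟩ʳ i) ∙ conj x) (proj₂ (entries j (σ ⟨$⟩ʳ i)) σi≢σj) ⟩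
      A i (σ ⟨$⟩ʳ i) ∙ conj zeroQ             ≡⟨ ∙-zeroʳ (A i (σ ⟨$⟩ʳ i)) ⟩
      zeroQ                                   ≡⟨ idMat-off i≢j ⟨
      idMat i j                               ∎
      where
      σi≢σj : σ ⟨$⟩ʳ i ≢ σ ⟨$⟩ʳ j
      σi≢σj σi≡σj = i≢j (trans (sym (inverseˡ σ)) (trans (cong (σ ⟨$⟩ˡ_) σi≡σj) (inverseˡ σ)))

module Definite {a b : ℚ} (definite : IsDefinite a b) where

  open QuaternionAlgebra a b

  private
    0<1 : 0ℚ ℚ.< 1ℚ
    0<1 = ℚP.positive⁻¹ 1ℚ
    0<-a : 0ℚ ℚ.< - a
    0<-a = ℚP.neg-antimono-< (proj₁ definite)
    0<-b : 0ℚ ℚ.< - b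
    0<-b = ℚP.neg-antimono-< (proj₂ definite)
    0<ab : 0ℚ ℚ.< a * b
    0<ab = ℚP.positive⁻¹ (a * b) {{ℚP.neg*neg⇒pos a {{ℚ.negative (proj₁ definite)}} b {{ℚ.negative (proj₂ definite)}}}}

  N-nonNegative : ∀ x → 0ℚ ℚ.≤ N x
  N-nonNegative x = subst (0ℚ ℚ.≤_) (sym (N≡sum-of-squares x))
    (ℚP.+-mono-≤ (ℚP.+-mono-≤ (ℚP.+-mono-≤ (0≤c*x*x (q0 x) 0<1) (0≤c*x*x (q1 x) 0<-a)) (0≤c*x*x (q2 x) 0<-b))
                 (0≤c*x*x (q3 x) 0<ab))

  N≡0⇒≡zeroQ : ∀ x → N x ≡ 0ℚ → x ≡ zeroQ
  N≡0⇒≡zeroQ x@(quat x0 x1 x2 x3) N≡0 =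
    quat-cong (c*x*x≡0⇒x≡0 0<1 (proj₁ s0+s1≡0)) (c*x*x≡0⇒x≡0 0<-a (proj₂ s0+s1≡0))
              (c*x*x≡0⇒x≡0 0<-b (proj₂ s0+s1+s2≡0)) (c*x*x≡0⇒x≡0 0<ab (proj₂ s0+s1+s2+s3≡0))
    where
    s0 s1 s2 s3 : ℚ
    s0 = 1ℚ * (x0 * x0)
    s1 = - a * (x1 * x1)
    s2 = - b * (x2 * x2)
    s3 = a * b * (x3 * x3)
    0≤s0 : 0ℚ ℚ.≤ s0
    0≤s0 = 0≤c*x*x x0 0<1
    0≤s1 : 0ℚ ℚ.≤ s1
    0≤s1 = 0≤c*x*x x1 0<-a
    0≤s2 : 0ℚ ℚ.≤ s2
    0≤s2 = 0≤c*x*x x2 0<-b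
    0≤s3 : 0ℚ ℚ.≤ s3
    0≤s3 = 0≤c*x*x x3 0<ab
    s0+s1+s2+s3≡0 : s0 + s1 + s2 ≡ 0ℚ × s3 ≡ 0ℚ
    s0+s1+s2+s3≡0 = nonNegative-+≡0 (ℚP.+-mono-≤ (ℚP.+-mono-≤ 0≤s0 0≤s1) 0≤s2) 0≤s3 (trans (sym (N≡sum-of-squares x)) N≡0)
    s0+s1+s2≡0 : s0 + s1 ≡ 0ℚ × s2 ≡ 0ℚ
    s0+s1+s2≡0 = nonNegative-+≡0 (ℚP.+-mono-≤ 0≤s0 0≤s1) 0≤s2 (proj₁ s0+s1+s2+s3≡0)
    s0+s1≡0 : s0 ≡ 0ℚ × s1 ≡ 0ℚ
    s0+s1≡0 = nonNegative-+≡0 0≤s0 0≤s1 (proj₁ s0+s1+s2≡0)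

  -- Each row of A A* = I says that the natural numbers N (A i k) sum to 1.
  unitary⇒monomial : ∀ {n} {A : Mat n} → (∀ i j → IsNatural (N (A i j))) → IsUnitary a b A →
                     IsMonomial (λ x → N x ≡ 1ℚ) A
  unitary⇒monomial {n} {A} natural unitary = π , λ i j →
      (λ j≡πi → subst (λ k → N (A i k) ≡ 1ℚ) (sym (trans j≡πi (π≗σ i))) (N-on-σ i))
    , (λ j≢πi → off-σ i j (j≢πi ∘ flip trans (sym (π≗σ i))))
    where
    ν : Fin n → Fin n → ℕ
    ν i j = proj₁ (natural i j)

    row-sum : ∀ i → sum (ν i) ≡ 1
    row-sum i = ℕ→ℚ-injective (begin
      ℕ→ℚ (sum (ν i))                            ≡⟨ q0-sumFin (λ k → A i k ∙ conj (A i k)) (ν i) (λ k → proj₂ (natural i k)) ⟨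
      q0 (sumFin (λ k → A i k ∙ conj (A i k)))   ≡⟨ cong q0 (trans (unitary i i) (idMat-diag i)) ⟩
      1ℚ                                         ∎)
      where open ≡-Reasoning

    row : ∀ i → ∃ λ k → ν i k ≡ 1 × ∀ j → j ≢ k → ν i j ≡ 0
    row i = sum≡1⇒unique (ν i) (row-sum i)

    σ : Fin n → Fin n
    σ i = proj₁ (row i)

    N-on-σ : ∀ i → N (A i (σ i)) ≡ 1ℚ
    N-on-σ i = trans (proj₂ (natural i (σ i))) (cong ℕ→ℚ (proj₁ (proj₂ (row i))))

    off-σ : ∀ i j → j ≢ σ i → A i j ≡ zeroQ
    off-σ i j j≢σi = N≡0⇒≡zeroQ (A i j) (trans (proj₂ (natural i j)) (cong ℕ→ℚ (proj₂ (proj₂ (row i)) j j≢σi)))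

    σ-injective : Injective _≡_ _≡_ σ
    σ-injective {i} {j} σi≡σj = decided (i FinP.≟ j)
      where
      open ≡-Reasoning
      N-on-σj : N (A j (σ i)) ≡ 1ℚ
      N-on-σj = subst (λ k → N (A j k) ≡ 1ℚ) (sym σi≡σj) (N-on-σ j)
      product≡0 : i ≢ j → A i (σ i) ∙ conj (A j (σ i)) ≡ zeroQ
      product≡0 i≢j = begin
        A i (σ i) ∙ conj (A j (σ i))          ≡⟨ sumFin-single (λ k → A i k ∙ conj (A j k)) (σ i)
                                                   (λ k k≢σi → trans (cong (λ x → x ∙ conj (A j k)) (off-σ i k k≢σi))
                                                                     (∙-zeroˡ (conj (A j k)))) ⟨
        sumFin (λ k → A i k ∙ conj (A j k))   ≡⟨ unitary i j ⟩
        idMat i j                             ≡⟨ idMat-off i≢j ⟩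
        zeroQ                                 ∎
      decided : Dec (i ≡ j) → i ≡ j
      decided (yes i≡j) = i≡j
      decided (no i≢j)  = ⊥-elim (ℚP.1≢0 (begin
        1ℚ                                     ≡⟨ cong₂ _*_ (N-on-σ i) (trans (N-conj (A j (σ i))) N-on-σj) ⟨
        N (A i (σ i)) * N (conj (A j (σ i)))   ≡⟨ N-∙ (A i (σ i)) (conj (A j (σ i))) ⟨
        N (A i (σ i) ∙ conj (A j (σ i)))       ≡⟨ cong N (product≡0 i≢j) ⟩
        N zeroQ                                ≡⟨ N-zeroQ ⟩
        0ℚ                                     ∎))

    π : Permutation′ n
    π = proj₁ (injective⇒permutation σ σ-injective)

    π≗σ : ∀ i → π ⟨$⟩ʳ i ≡ σ i
    π≗σ = proj₂ (injective⇒permutation σ σ-injective)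

module Order {a b : ℚ} {O : Subset} (isOrder : IsOrder a b O) where

  open IsOrder isOrder
  open QuaternionAlgebra a b

  span : (Fin 4 → ℤ) → Quat
  span c = sumFin (λ i → ℤ→ℚ (c i) · basis i)

  span∈O : ∀ c → O (span c)
  span∈O c = proj₂ (lattice (span c)) c refl

  ∈O⇒span : ∀ {x} → O x → ∃ λ c → x ≡ span c
  ∈O⇒span {x} = proj₁ (lattice x)

  span-⊕ : ∀ c d → span c ⊕ span d ≡ span (λ i → c i ℤ.+ d i)
  span-⊕ c d = trans (sumFin-⊕ (λ i → ℤ→ℚ (c i) · basis i) (λ i → ℤ→ℚ (d i) · basis i)) (sumFin-cong λ i → sym (begin
    ℤ→ℚ (c i ℤ.+ d i) · basis i                   ≡⟨ cong (_· basis i) (ℤ→ℚ-homo-+ (c i) (d i)) ⟩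
    (ℤ→ℚ (c i) + ℤ→ℚ (d i)) · basis i             ≡⟨ ·-distribʳ-+ (ℤ→ℚ (c i)) (ℤ→ℚ (d i)) (basis i) ⟩
    ℤ→ℚ (c i) · basis i ⊕ ℤ→ℚ (d i) · basis i     ∎))
    where open ≡-Reasoning

  span-· : ∀ z c → ℤ→ℚ z · span c ≡ span (λ i → z ℤ.* c i)
  span-· z c = trans (sumFin-· (ℤ→ℚ z) (λ i → ℤ→ℚ (c i) · basis i)) (sumFin-cong λ i → begin
    ℤ→ℚ z · (ℤ→ℚ (c i) · basis i)   ≡⟨ ·-assoc (ℤ→ℚ z) (ℤ→ℚ (c i)) (basis i) ⟩
    (ℤ→ℚ z * ℤ→ℚ (c i)) · basis i    ≡⟨ cong (_· basis i) (ℤ→ℚ-homo-* z (c i)) ⟨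
    ℤ→ℚ (z ℤ.* c i) · basis i        ∎)
    where open ≡-Reasoning

  O-⊕ : ∀ {x y} → O x → O y → O (x ⊕ y)
  O-⊕ ox oy with ∈O⇒span ox | ∈O⇒span oy
  ... | c , refl | d , refl = subst O (sym (span-⊕ c d)) (span∈O (λ i → c i ℤ.+ d i))

  O-· : ∀ z {x} → O x → O (ℤ→ℚ z · x)
  O-· z ox with ∈O⇒span ox
  ... | c , refl = subst O (sym (span-· z c)) (span∈O (λ i → z ℤ.* c i))

  O-⊖ : ∀ {x} → O x → O (⊖ x)
  O-⊖ {x} ox = subst O (sym (⊖≡-1· x)) (O-· ℤ.-1ℤ ox)

  O-zeroQ : O zeroQ
  O-zeroQ = O-· (+ 0) has-one

  O-∙^ : ∀ {x} → O x → ∀ k → O (x ∙^ k)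
  O-∙^ ox ℕ.zero        = has-one
  O-∙^ {x} ox (ℕ.suc k) = mul-closed x (x ∙^ k) ox (O-∙^ ox k)

  O-bounded-denominators : ∃ λ D → NonZero D × ∀ {x} → O x → IsIntegral (ℕ→ℚ D · x)
  O-bounded-denominators = bounded (common-multiple (λ d i → d Clears basis i)
                                      (λ i d∣e d-clears m → ∣-clears (coord (basis i) m) d∣e (d-clears m))
                                      (λ i → denominator-exists (basis i)))
    where
    bounded : (∃ λ D → NonZero D × ∀ i → D Clears basis i) →
              ∃ λ D → NonZero D × ∀ {x} → O x → IsIntegral (ℕ→ℚ D · x)
    bounded (D , D≢0 , D-clears) = D , D≢0 , λ ox → D-integral (∈O⇒span ox)
      where
      D-integral : ∀ {x} → (∃ λ c → x ≡ span c) → IsIntegral (ℕ→ℚ D · x)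
      D-integral (c , refl) = subst IsIntegral (sym D·span)
                                (IsIntegral-sumFin (λ i → ℤ→ℚ (c i) · (ℕ→ℚ D · basis i))
                                   λ i → IsIntegral-· (c i) (Clears⇒IsIntegral {D} {basis i} (D-clears i)))
        where
        D·span : ℕ→ℚ D · span c ≡ sumFin (λ i → ℤ→ℚ (c i) · (ℕ→ℚ D · basis i))
        D·span = trans (sumFin-· (ℕ→ℚ D) (λ i → ℤ→ℚ (c i) · basis i))
                       (sumFin-cong λ i → ·-comm (ℕ→ℚ D) (ℤ→ℚ (c i)) (basis i))

  N-bounded-denominators : ∃ λ E → NonZero E × ∀ {x} → O x → IsInteger (ℕ→ℚ E * N x)
  N-bounded-denominators = bounded O-bounded-denominators
    where
    A : ℕ
    A = ↧ₙ a ℕ.* ↧ₙ b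
    bounded : (∃ λ D → NonZero D × ∀ {x} → O x → IsIntegral (ℕ→ℚ D · x)) →
              ∃ λ E → NonZero E × ∀ {x} → O x → IsInteger (ℕ→ℚ E * N x)
    bounded (D , D≢0 , D-integral) =
      A ℕ.* (D ℕ.* D) , ℕP.m*n≢0 A (D ℕ.* D) {{ℕP.m*n≢0 (↧ₙ a) (↧ₙ b)}} {{ℕP.m*n≢0 D D {{D≢0}} {{D≢0}}}} ,
      λ {x} ox → subst IsInteger (sym (begin
        ℕ→ℚ (A ℕ.* (D ℕ.* D)) * N x              ≡⟨ cong (_* N x) (ℕ→ℚ-homo-* A (D ℕ.* D)) ⟩
        ℕ→ℚ A * ℕ→ℚ (D ℕ.* D) * N x              ≡⟨ ℚP.*-assoc (ℕ→ℚ A) (ℕ→ℚ (D ℕ.* D)) (N x) ⟩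
        ℕ→ℚ A * (ℕ→ℚ (D ℕ.* D) * N x)            ≡⟨ cong (λ d → ℕ→ℚ A * (d * N x)) (ℕ→ℚ-homo-* D D) ⟩
        ℕ→ℚ A * (ℕ→ℚ D * ℕ→ℚ D * N x)            ≡⟨ cong (ℕ→ℚ A *_) (N-· (ℕ→ℚ D) x) ⟨
        ℕ→ℚ A * N (ℕ→ℚ D · x)                    ∎))
        (IsIntegral⇒↧a↧b*N-integer (D-integral ox))
      where open ≡-Reasoning

  N-integer : ∀ {x} → O x → IsInteger (N x)
  N-integer {x} ox = bounded-denominators⇒integer E {{E≢0}} (N x) λ k →
    subst IsInteger (cong (ℕ→ℚ E *_) (N-∙^ x k)) (E-clears (O-∙^ ox k))
    where
    E : ℕ
    E = proj₁ N-bounded-denominators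
    E≢0 : NonZero E
    E≢0 = proj₁ (proj₂ N-bounded-denominators)
    E-clears : ∀ {y} → O y → IsInteger (ℕ→ℚ E * N y)
    E-clears = proj₂ (proj₂ N-bounded-denominators)

  trace-integer : ∀ {x} → O x → IsInteger (q0 x + q0 x)
  trace-integer {x} ox = subst IsInteger (sym trace≡) integer
    where
    open ≡-Reasoning
    isolate : ∀ n t → t ≡ n + t + 1ℚ + - n + - 1ℚ
    isolate = solve 2 (λ n t → t := n :+ t :+ con 1ℚ :+ :- n :+ :- con 1ℚ) refl
    trace≡ : q0 x + q0 x ≡ N (x ⊕ oneQ) + - N x + - 1ℚ
    trace≡ = begin
      q0 x + q0 x                               ≡⟨ isolate (N x) (q0 x + q0 x) ⟩
      N x + (q0 x + q0 x) + 1ℚ + - N x + - 1ℚ   ≡⟨ cong (λ n → n + - N x + - 1ℚ) (N-⊕oneQ x) ⟨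
      N (x ⊕ oneQ) + - N x + - 1ℚ               ∎
    -- The implicit arguments are given so that unification never unfolds ℚ._+_.
    integer : IsInteger (N (x ⊕ oneQ) + - N x + - 1ℚ)
    integer = IsInteger-+ {N (x ⊕ oneQ) + - N x} { - 1ℚ}
                (IsInteger-+ {N (x ⊕ oneQ)} { - N x} (N-integer (O-⊕ ox has-one)) (IsInteger-neg {N x} (N-integer ox)))
                (IsInteger-neg {1ℚ} (IsInteger-ℤ→ℚ (+ 1)))

  O-conj : ∀ {x} → O x → O (conj x)
  O-conj {x} ox = subst O (sym conj≡) (O-⊕ {ℤ→ℚ t · oneQ} {⊖ x} (O-· t has-one) (O-⊖ ox))
    where
    t : ℤ
    t = proj₁ (trace-integer ox)
    conj≡ : conj x ≡ ℤ→ℚ t · oneQ ⊕ ⊖ x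
    conj≡ = trans (conj≡trace·oneQ⊖ x) (cong (λ r → r · oneQ ⊕ ⊖ x) (proj₂ (trace-integer ox)))

module DefiniteOrder {a b : ℚ} (definite : IsDefinite a b) {O : Subset} (isOrder : IsOrder a b O) where

  open IsOrder isOrder
  open QuaternionAlgebra a b
  open Definite definite
  open Order isOrder

  N-natural : ∀ {x} → O x → IsNatural (N x)
  N-natural {x} ox = nonNegative-integer⇒natural (N-nonNegative x) (N-integer ox)

  unit⇒N≡1 : ∀ {u} → IsUnitIn a b O u → N u ≡ 1ℚ
  unit⇒N≡1 {u} (ou , v , ov , u∙v≡1 , _) = norms (N-natural ou) (N-natural ov)
    where
    open ≡-Reasoning
    norms : IsNatural (N u) → IsNatural (N v) → N u ≡ 1ℚ
    norms (m , Nu≡m) (n , Nv≡n) = trans Nu≡m (cong ℕ→ℚ (ℕP.m*n≡1⇒m≡1 m n (ℕ→ℚ-injective (begin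
      ℕ→ℚ (m ℕ.* n)     ≡⟨ ℕ→ℚ-homo-* m n ⟩
      ℕ→ℚ m * ℕ→ℚ n     ≡⟨ cong₂ _*_ Nu≡m Nv≡n ⟨
      N u * N v         ≡⟨ N-∙ u v ⟨
      N (u ∙ v)         ≡⟨ cong N u∙v≡1 ⟩
      N oneQ            ≡⟨ N-oneQ ⟩
      1ℚ                ∎))))

  N≡1⇒unit : ∀ {u} → O u → N u ≡ 1ℚ → IsUnitIn a b O u
  N≡1⇒unit {u} ou Nu≡1 = ou , conj u , O-conj ou ,
    trans (∙-conj u) (cong (_· oneQ) Nu≡1) , trans (conj-∙ u) (cong (_· oneQ) Nu≡1)

  unitary⇔monomial-unit : ∀ {n} {A : Mat n} → EntriesIn O A → IsUnitary a b A ⇔ IsMonomialUnit a b O A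
  unitary⇔monomial-unit {A = A} A∈O = mk⇔
    (λ unitary → IsMonomial-map {λ x → N x ≡ 1ℚ} {IsUnitIn a b O} (λ {i} {j} → N≡1⇒unit (A∈O i j))
                   (unitary⇒monomial (λ i j → N-natural (A∈O i j)) unitary))
    (λ monomial → monomial⇒unitary (IsMonomial-map {IsUnitIn a b O} {λ x → N x ≡ 1ℚ} unit⇒N≡1 monomial))

  norm-one∉2O : ∀ {x y} → O y → N x ≡ 1ℚ → x ≢ twoℚ · y
  norm-one∉2O {x} {y} oy Nx≡1 x≡2y = 4≢1 (ℕP.m*n≡1⇒m≡1 4 m (ℕ→ℚ-injective (begin
    ℕ→ℚ (4 ℕ.* m)        ≡⟨ ℕ→ℚ-homo-* 4 m ⟩
    ℕ→ℚ 4 * ℕ→ℚ m        ≡⟨ cong (ℕ→ℚ 4 *_) Ny≡m ⟨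
    twoℚ * twoℚ * N y    ≡⟨ N-· twoℚ y ⟨
    N (twoℚ · y)         ≡⟨ cong N x≡2y ⟨
    N x                  ≡⟨ Nx≡1 ⟩
    1ℚ                   ∎)))
    where
    open ≡-Reasoning
    m : ℕ
    m = proj₁ (N-natural oy)
    Ny≡m : N y ≡ ℕ→ℚ m
    Ny≡m = proj₂ (N-natural oy)
    4≢1 : 4 ≢ 1
    4≢1 ()

  ≡oneQ-mod-2⇒±oneQ : ∀ {u y} → O y → N u ≡ 1ℚ → u ⊕ ⊖ oneQ ≡ twoℚ · y → u ≡ oneQ ⊎ u ≡ ⊖ oneQ
  ≡oneQ-mod-2⇒±oneQ {u} {y} oy Nu≡1 u-1≡2y = signs (N-natural oy)
    where
    open ≡-Reasoning
    u≡2y+1 : u ≡ twoℚ · y ⊕ oneQ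
    u≡2y+1 = trans (sym (⊖⊕-cancelʳ u oneQ)) (cong (_⊕ oneQ) u-1≡2y)

    y0≡-Ny : q0 y ≡ - N y
    y0≡-Ny = 4n+4t+1≡1⇒t≡-n (N y) (q0 y) (begin
      twoℚ * twoℚ * N y + (twoℚ * q0 y + twoℚ * q0 y) + 1ℚ   ≡⟨ cong (λ r → r + (twoℚ * q0 y + twoℚ * q0 y) + 1ℚ) (N-· twoℚ y) ⟨
      N (twoℚ · y) + (twoℚ * q0 y + twoℚ * q0 y) + 1ℚ        ≡⟨ N-⊕oneQ (twoℚ · y) ⟨
      N (twoℚ · y ⊕ oneQ)                                    ≡⟨ cong N u≡2y+1 ⟨
      N u                                                    ≡⟨ Nu≡1 ⟩
      1ℚ                                                     ∎)

    N-vectorPart≡ : N (vectorPart y) ≡ N y + - (N y * N y)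
    N-vectorPart≡ = begin
      N (vectorPart y)                                  ≡⟨ isolate (N (vectorPart y)) (q0 y) ⟩
      q0 y * q0 y + N (vectorPart y) + - (q0 y * q0 y)  ≡⟨ cong₂ (λ s t → s + - (t * t))
                                                             (sym (N≡q0²+N-vectorPart y)) y0≡-Ny ⟩
      N y + - (- N y * - N y)                           ≡⟨ neg-square (N y) ⟩
      N y + - (N y * N y)                               ∎
      where
      isolate : ∀ p t → p ≡ t * t + p + - (t * t)
      isolate = solve 2 (λ p t → p := t :* t :+ p :+ :- (t :* t)) refl
      neg-square : ∀ n → n + - (- n * - n) ≡ n + - (n * n)
      neg-square = solve 1 (λ n → n :+ :- (:- n :* :- n) := n :+ :- (n :* n)) refl

    signs : IsNatural (N y) → u ≡ oneQ ⊎ u ≡ ⊖ oneQ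
    signs (0 , Ny≡0) = inj₁ (trans u≡2y+1 (cong (λ z → twoℚ · z ⊕ oneQ) (N≡0⇒≡zeroQ y Ny≡0)))
    signs (1 , Ny≡1) = inj₂ (trans u≡2y+1 (cong (λ z → twoℚ · z ⊕ oneQ) y≡-1))
      where
      vectorPart≡0 : vectorPart y ≡ zeroQ
      vectorPart≡0 = N≡0⇒≡zeroQ (vectorPart y) (trans N-vectorPart≡ (cong (λ n → n + - (n * n)) Ny≡1))
      y≡-1 : y ≡ ⊖ oneQ
      y≡-1 = quat-cong (trans y0≡-Ny (cong -_ Ny≡1)) (cong q1 vectorPart≡0) (cong q2 vectorPart≡0) (cong q3 vectorPart≡0)
    signs (ℕ.suc (ℕ.suc k) , Ny≡m) = ⊥-elim (2+k≰1 (square≤⇒≤1 (ℕ.suc (ℕ.suc k)) (0≤p-q⇒q≤p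
      (subst (λ n → 0ℚ ℚ.≤ n + - (n * n)) Ny≡m (subst (0ℚ ℚ.≤_) N-vectorPart≡ (N-nonNegative (vectorPart y)))))))
      where
      2+k≰1 : ℕ.suc (ℕ.suc k) ℕ.≰ 1
      2+k≰1 (ℕ.s≤s ())

  unitary-mod-2⇒diagonal-signs : ∀ {n} {A : Mat n} → EntriesIn O A → IsUnitary a b A → InKerMod2 O A →
                                 IsDiagSigns A
  unitary-mod-2⇒diagonal-signs {n} {A} A∈O unitary A≡I = λ i j → (λ { refl → diagonal i }) , off-diagonal i j
    where
    monomial : IsMonomial (λ x → N x ≡ 1ℚ) A
    monomial = unitary⇒monomial (λ i j → N-natural (A∈O i j)) unitary

    σ : Permutation′ n
    σ = proj₁ monomial

    A≡I-diag : ∀ i → ∃ λ y → O y × A i i ⊕ ⊖ oneQ ≡ twoℚ · y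
    A≡I-diag i = let (y , oy , eq) = A≡I i i in y , oy , trans (cong (λ e → A i i ⊕ ⊖ e) (sym (idMat-diag i))) eq

    A≡I-off : ∀ {i j} → i ≢ j → ∃ λ y → O y × A i j ≡ twoℚ · y
    A≡I-off {i} {j} i≢j = let (y , oy , eq) = A≡I i j in
      y , oy , trans (sym (⊕-identityʳ (A i j))) (trans (cong (λ e → A i j ⊕ ⊖ e) (sym (idMat-off i≢j))) eq)

    diagonal-case : ∀ i → Dec (i ≡ σ ⟨$⟩ʳ i) → A i i ≡ oneQ ⊎ A i i ≡ ⊖ oneQ
    diagonal-case i (yes i≡σi) = let (y , oy , eq) = A≡I-diag i in
      ≡oneQ-mod-2⇒±oneQ oy (proj₁ (proj₂ monomial i i) i≡σi) eq
    diagonal-case i (no i≢σi) = let (y , oy , eq) = A≡I-diag i in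
      ⊥-elim (norm-one∉2O oy N-⊖oneQ (trans (cong (_⊕ ⊖ oneQ) (sym (proj₂ (proj₂ monomial i i) i≢σi))) eq))
      where
      N-⊖oneQ : N (zeroQ ⊕ ⊖ oneQ) ≡ 1ℚ
      N-⊖oneQ = trans (cong N (⊕-identityˡ (⊖ oneQ))) (trans (N-⊖ oneQ) N-oneQ)

    diagonal : ∀ i → A i i ≡ oneQ ⊎ A i i ≡ ⊖ oneQ
    diagonal i = diagonal-case i (i FinP.≟ σ ⟨$⟩ʳ i)

    off-diagonal-case : ∀ i j → i ≢ j → Dec (j ≡ σ ⟨$⟩ʳ i) → A i j ≡ zeroQ
    off-diagonal-case i j i≢j (yes j≡σi) = let (y , oy , eq) = A≡I-off i≢j in
      ⊥-elim (norm-one∉2O oy (proj₁ (proj₂ monomial i j) j≡σi) eq)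
    off-diagonal-case i j i≢j (no j≢σi) = proj₂ (proj₂ monomial i j) j≢σi

    off-diagonal : ∀ i j → i ≢ j → A i j ≡ zeroQ
    off-diagonal i j i≢j = off-diagonal-case i j i≢j (j FinP.≟ σ ⟨$⟩ʳ i)

  diagonal-signs⇒unitary-mod-2 : ∀ {n} {A : Mat n} → IsDiagSigns A → IsUnitary a b A × InKerMod2 O A
  diagonal-signs⇒unitary-mod-2 {n} {A} signs = monomial⇒unitary monomial , A≡I
    where
    monomial : IsMonomial (λ x → N x ≡ 1ℚ) A
    monomial = Perm.id , λ i j → (λ { refl → N-±oneQ (proj₁ (signs i i) refl) }) , (λ j≢i → proj₂ (signs i j) (j≢i ∘ sym))
      where
      N-±oneQ : ∀ {x} → x ≡ oneQ ⊎ x ≡ ⊖ oneQ → N x ≡ 1ℚ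
      N-±oneQ (inj₁ refl) = N-oneQ
      N-±oneQ (inj₂ refl) = trans (N-⊖ oneQ) N-oneQ

    ±oneQ≡oneQ-mod-2 : ∀ {x} → x ≡ oneQ ⊎ x ≡ ⊖ oneQ → ∃ λ y → O y × x ⊕ ⊖ oneQ ≡ twoℚ · y
    ±oneQ≡oneQ-mod-2 (inj₁ refl) = zeroQ , O-zeroQ , refl
    ±oneQ≡oneQ-mod-2 (inj₂ refl) = ⊖ oneQ , O-⊖ has-one , refl

    A≡I-case : ∀ i j → Dec (i ≡ j) → ∃ λ y → O y × A i j ⊕ ⊖ idMat i j ≡ twoℚ · y
    A≡I-case i j (yes refl) = subst (λ e → ∃ λ y → O y × A i i ⊕ ⊖ e ≡ twoℚ · y) (sym (idMat-diag i))
                                    (±oneQ≡oneQ-mod-2 (proj₁ (signs i i) refl))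
    A≡I-case i j (no i≢j)   = zeroQ , O-zeroQ , cong₂ (λ x e → x ⊕ ⊖ e) (proj₂ (signs i j) i≢j) (idMat-off i≢j)

    A≡I : InKerMod2 O A
    A≡I i j = A≡I-case i j (i FinP.≟ j)

  unitary-mod-2⇔diagonal-signs : ∀ {n} {A : Mat n} → EntriesIn O A →
                                 (IsUnitary a b A × InKerMod2 O A) ⇔ IsDiagSigns A
  unitary-mod-2⇔diagonal-signs A∈O =
    mk⇔ (λ (unitary , A≡I) → unitary-mod-2⇒diagonal-signs A∈O unitary A≡I) diagonal-signs⇒unitary-mod-2

lemma6p1 : ((a b : ℚ) → IsDefinite a b → (O : Subset) → IsOrder a b O →
    (n : ℕ) → n ≥ 1 → (A : Mat n) → EntriesIn O A →
    IsUnitary a b A ⇔ IsMonomialUnit a b O A)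
    ×
    ((O : Subset) → IsMaximalOrder (- 1ℚ) (- 1ℚ) O →
    (n : ℕ) → n ≥ 1 → (A : Mat n) → EntriesIn O A →
    (IsUnitary (- 1ℚ) (- 1ℚ) A × InKerMod2 O A) ⇔ IsDiagSigns A)
lemma6p1 = (λ a b definite O isOrder n _ A A∈O → DefiniteOrder.unitary⇔monomial-unit definite isOrder A∈O)
         , (λ O maximal n _ A A∈O → DefiniteOrder.unitary-mod-2⇔diagonal-signs (-1<0 , -1<0) (proj₁ maximal) A∈O)
  where
  -1<0 : - 1ℚ ℚ.< 0ℚ
  -1<0 = ℚP.negative⁻¹ (- 1ℚ)
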